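{- Let $G$ be a finite simple graph containing two adjacent vertices $u$ and $v$ such that $N_{G-v}(u)=N_{G-u}(v)=L$ and all vertices of $L$ are pairwise adjacent. Then \[ J(G)=(1+x+y)J(G-v)-(x+y)J(G-v-u)-x(1-y)y^{|N_G(u)|-1}J(G-N_G[u]). \]
   Context: For a finite simple graph $G$ and $W\subseteq V(G)$, $N_G[W]$ is the set of vertices that are in $W$ or adjacent to a vertex of $W$, and $N_G(W):=N_G[W]\setminus W$; for a vertex $a$, $N_G(a)$ is the set of neighbours of $a$ and $N_G[a]=N_G(a)\cup\{a\}$; $N_{G-v}(u)$ is the neighbourhood of $u$ in the graph $G-v$. The bivariate domination polynomial is $J(G;x,y)=J(G):=\sum_{W\subseteq V(G)} x^{|W|}y^{|N_G(W)|}$ (the graph with no vertices has $J=1$). For $X\subseteq V(G)$, $G-X$ is obtained by deleting the vertices of $X$. -}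

module Defs where

open import Level using (Level)
open import Data.Bool using (Bool; true; false)
open import Data.Nat using (ℕ; zero; suc)
open import Data.Fin using (Fin)
open import Data.Fin.Subset using (Subset; inside; outside; _∈_; _⊆_; _∪_; _∩_; _─_; ⋃; ∣_∣; ⁅_⁆)
open import Data.Fin.Subset.Properties using (_∈?_; _⊆?_)
open import Data.Vec using (Vec; []; _∷_; tabulate)
open import Data.List using (List; []; _∷_; _++_; map; filter; foldr; allFin)
open import Relation.Binary.PropositionalEquality using (_≡_)
open import Algebra.Bundles using (CommutativeRing)

record Graph (n : ℕ) : Set where
  field
    adj    : Fin n → Fin n → Bool
    sym    : ∀ a b → adj a b ≡ adj b a
    irrefl : ∀ a → adj a a ≡ false

open Graph public

_~[_]_ : ∀ {n} → Fin n → Graph n → Fin n → Set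
a ~[ G ] b = adj G a b ≡ true

allSubsets : (n : ℕ) → List (Subset n)
allSubsets zero    = [] ∷ []
allSubsets (suc n) = map (inside ∷_) (allSubsets n) ++ map (outside ∷_) (allSubsets n)

-- Throughout, the induced subgraph G[S] is represented by its vertex set
-- S ⊆ V(G) = Fin n; in particular G - X is G[⊤ ─ X].

nbhd : ∀ {n} → Graph n → Subset n → Fin n → Subset n
nbhd G S a = tabulate (λ w → adj G a w) ∩ S

elems : ∀ {n} → Subset n → List (Fin n)
elems {n} W = filter (_∈? W) (allFin n)

closedNbhdSet : ∀ {n} → Graph n → Subset n → Subset n → Subset n
closedNbhdSet G S W = W ∪ ⋃ (map (nbhd G S) (elems W))

openNbhdSet : ∀ {n} → Graph n → Subset n → Subset n → Subset n
openNbhdSet G S W = closedNbhdSet G S W ─ W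

closedNbhd : ∀ {n} → Graph n → Subset n → Fin n → Subset n
closedNbhd G S a = closedNbhdSet G S ⁅ a ⁆

module _ {c ℓ : Level} (R : CommutativeRing c ℓ) where
  open CommutativeRing R

  pow : Carrier → ℕ → Carrier
  pow r zero    = 1#
  pow r (suc k) = r * pow r k

  sumR : List Carrier → Carrier
  sumR = foldr _+_ 0#

  J : ∀ {n} → Graph n → Subset n → Carrier → Carrier → Carrier
  J {n} G S x y =
    sumR (map (λ W → pow x ∣ W ∣ * pow y ∣ openNbhdSet G S W ∣)
              (filter (_⊆? S) (allSubsets n)))

module Submission where

-- Every subset of V(G) is of the
-- form W, W+v, W+u or W+u+v for a unique W avoiding u and v, so each of the
-- four polynomials in the statement is a sum over such W of the four terms
-- indexed by W, W+v, W+u, W+u+v (lemma split-at-two).  The theorem then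
-- follows by linearity once the identity holds for each W separately.
--
-- For fixed W, all the neighbourhoods involved agree outside {u,v} with
-- one of two "cores", N_{G-u-v}(W) and N_{G-u-v}(W+u), so their sizes are
-- read off from which of u, v they contain (lemma ∣∣-outside-two).  Two
-- cases remain.  If W dominates u then, u and v being twins and their common
-- neighbourhood L a clique, W dominates v and all of L, and the two cores
-- coincide.  Otherwise W ⊆ V - N[u], and the second core is the disjoint
-- union of N_{G-N[u]}(W) and L, where |L| = |N(u)| - 1.  In either case the
-- per-W identity is a polynomial identity in the ring.
--
-- Here "W dominates z" means that z has a neighbour in W.

open import Defs hiding (sym)
open import Level using (Level; 0ℓ)
open import Data.Bool using (Bool; true; false; not; _∧_; _∨_; if_then_else_)
open import Data.Bool.Properties using (∧-identityʳ; ∧-zeroʳ; ∨-zeroʳ; ⇔→≡)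
open import Function.Base using (_∘_)
open import Function.Bundles using (mk⇔)
open import Data.Nat using (ℕ; zero; suc; _∸_) renaming (_+_ to _+ℕ_)
open import Data.Nat.Properties using (+-suc)
open import Data.Fin using (Fin; zero; suc; _≟_)
open import Data.Fin.Subset using (Subset; inside; outside; _∈_; _─_; _∪_; _∩_; ⋃; ⁅_⁆; ∣_∣; ⊤; ⊥)
open import Data.Fin.Subset.Properties using (_∈?_; _⊆?_)
open import Data.Vec using ([]; _∷_; lookup; tabulate; _[_]≔_)
open import Data.Vec.Properties
  using (lookup-zipWith; lookup-replicate; lookup∘tabulate; tabulate∘lookup; tabulate-cong;
         lookup∘update; lookup∘update′; []=⇒lookup; lookup⇒[]=)
open import Data.List using (List; []; _∷_; _++_; map; filter; allFin)
open import Data.List.Properties using (map-++; map-∘)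
open import Data.List.Membership.Propositional using () renaming (_∈_ to _∈ˡ_)
open import Data.List.Membership.Propositional.Properties using (∈-filter⁺; ∈-filter⁻; ∈-allFin)
open import Data.List.Relation.Unary.Any using (here; there)
open import Data.Product using (Σ-syntax; _×_; _,_; proj₂)
open import Data.Empty using (⊥-elim)
open import Relation.Nullary using (yes; no; does)
open import Relation.Nullary.Decidable using (dec-true; dec-false)
open import Relation.Unary using (Pred; Decidable)
open import Relation.Binary.PropositionalEquality
  using (_≡_; _≢_; refl; sym; trans; cong; cong₂; module ≡-Reasoning)
open import Algebra.Bundles using (CommutativeRing)

true≢false : true ≢ false
true≢false ()

subset-ext : ∀ {n} {p q : Subset n} → (∀ z → lookup p z ≡ lookup q z) → p ≡ q
subset-ext {p = p} {q} same = begin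
  p                   ≡⟨ sym (tabulate∘lookup p) ⟩
  tabulate (lookup p) ≡⟨ tabulate-cong same ⟩
  tabulate (lookup q) ≡⟨ tabulate∘lookup q ⟩
  q                   ∎
  where open ≡-Reasoning

lookup-∪ : ∀ {n} (p q : Subset n) z → lookup (p ∪ q) z ≡ lookup p z ∨ lookup q z
lookup-∪ p q z = lookup-zipWith _∨_ z p q

lookup-∩ : ∀ {n} (p q : Subset n) z → lookup (p ∩ q) z ≡ lookup p z ∧ lookup q z
lookup-∩ p q z = lookup-zipWith _∧_ z p q

lookup-─ : ∀ {n} (p q : Subset n) z → lookup (p ─ q) z ≡ lookup p z ∧ not (lookup q z)
lookup-─ (x ∷ p) (true  ∷ q) zero    = sym (∧-zeroʳ x)
lookup-─ (x ∷ p) (false ∷ q) zero    = sym (∧-identityʳ x)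
lookup-─ (_ ∷ p) (_     ∷ q) (suc z) = lookup-─ p q z

lookup-⊤ : ∀ {n} (z : Fin n) → lookup ⊤ z ≡ true
lookup-⊤ z = lookup-replicate z true

lookup-⊥ : ∀ {n} (z : Fin n) → lookup ⊥ z ≡ false
lookup-⊥ z = lookup-replicate z false

lookup-⊤─ : ∀ {n} (q : Subset n) z → lookup (⊤ ─ q) z ≡ not (lookup q z)
lookup-⊤─ q z rewrite lookup-─ ⊤ q z | lookup-⊤ z = refl

lookup-⁅⁆-self : ∀ {n} (a : Fin n) → lookup ⁅ a ⁆ a ≡ true
lookup-⁅⁆-self zero    = refl
lookup-⁅⁆-self (suc a) = lookup-⁅⁆-self a

lookup-⁅⁆-other : ∀ {n} (a z : Fin n) → z ≢ a → lookup ⁅ a ⁆ z ≡ false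
lookup-⁅⁆-other zero    zero    z≢a = ⊥-elim (z≢a refl)
lookup-⁅⁆-other zero    (suc z) z≢a = lookup-⊥ z
lookup-⁅⁆-other (suc a) zero    z≢a = refl
lookup-⁅⁆-other (suc a) (suc z) z≢a = lookup-⁅⁆-other a z (λ z≡a → z≢a (cong suc z≡a))

lookup-⁅⁆-member : ∀ {n} (a z : Fin n) → lookup ⁅ a ⁆ z ≡ true → z ≡ a
lookup-⁅⁆-member a z z∈a with z ≟ a
... | yes z≡a = z≡a
... | no  z≢a = ⊥-elim (true≢false (trans (sym z∈a) (lookup-⁅⁆-other a z z≢a)))

≢-by-membership : ∀ {n} (W : Subset n) {a b} → lookup W a ≡ true → lookup W b ≡ false → a ≢ b
≢-by-membership W a∈W b∉W refl = true≢false (trans (sym a∈W) b∉W)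

⊆?-true : ∀ {n} (W S : Subset n) → (∀ z → lookup W z ≡ true → lookup S z ≡ true) →
  does (W ⊆? S) ≡ true
⊆?-true W S W⊆S = dec-true (W ⊆? S) (λ {z} z∈W → lookup⇒[]= z S (W⊆S z ([]=⇒lookup z∈W)))

⊆?-false : ∀ {n} (W S : Subset n) z → lookup W z ≡ true → lookup S z ≡ false →
  does (W ⊆? S) ≡ false
⊆?-false W S z z∈W z∉S =
  dec-false (W ⊆? S) (λ W⊆S → true≢false (trans (sym ([]=⇒lookup (W⊆S (lookup⇒[]= z W z∈W)))) z∉S))

ind : Bool → ℕ
ind true  = 1
ind false = 0

∣∣-update : ∀ {n} (p : Subset n) a b → lookup p a ≡ false → ∣ p [ a ]≔ b ∣ ≡ ind b +ℕ ∣ p ∣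
∣∣-update (false ∷ p) zero    true  refl = refl
∣∣-update (false ∷ p) zero    false refl = refl
∣∣-update (true  ∷ p) (suc a) b     a∉p  =
  trans (cong suc (∣∣-update p a b a∉p)) (sym (+-suc (ind b) ∣ p ∣))
∣∣-update (false ∷ p) (suc a) b     a∉p  = ∣∣-update p a b a∉p

∣∣-outside-two : ∀ {n} {a b : Fin n} → a ≢ b → (p q : Subset n) →
  lookup q a ≡ false → lookup q b ≡ false →
  (∀ z → z ≢ a → z ≢ b → lookup p z ≡ lookup q z) →
  ∣ p ∣ ≡ ind (lookup p a) +ℕ (ind (lookup p b) +ℕ ∣ q ∣)
∣∣-outside-two {a = a} {b} a≢b p q a∉q b∉q agree = begin
  ∣ p ∣                                  ≡⟨ cong ∣_∣ p≡r ⟩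
  ∣ q [ b ]≔ lookup p b [ a ]≔ lookup p a ∣
    ≡⟨ ∣∣-update (q [ b ]≔ lookup p b) a (lookup p a) (trans (lookup∘update′ a≢b q _) a∉q) ⟩
  ind (lookup p a) +ℕ ∣ q [ b ]≔ lookup p b ∣
    ≡⟨ cong (ind (lookup p a) +ℕ_) (∣∣-update q b (lookup p b) b∉q) ⟩
  ind (lookup p a) +ℕ (ind (lookup p b) +ℕ ∣ q ∣) ∎
  where
  open ≡-Reasoning
  p≡r : p ≡ q [ b ]≔ lookup p b [ a ]≔ lookup p a
  p≡r = subset-ext pointwise
    where
    pointwise : ∀ z → lookup p z ≡ lookup (q [ b ]≔ lookup p b [ a ]≔ lookup p a) z
    pointwise z with z ≟ a | z ≟ b
    ... | yes refl | _        = sym (lookup∘update z (q [ b ]≔ lookup p b) (lookup p z))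
    ... | no z≢a   | yes refl = sym (trans (lookup∘update′ z≢a (q [ b ]≔ lookup p b) (lookup p a))
                                           (lookup∘update z q (lookup p z)))
    ... | no z≢a   | no z≢b   = trans (agree z z≢a z≢b)
      (sym (trans (lookup∘update′ z≢a (q [ b ]≔ lookup p b) (lookup p a))
                  (lookup∘update′ z≢b q (lookup p b))))

∣∪∣-disjoint : ∀ {n} (p q : Subset n) → (∀ z → lookup p z ∧ lookup q z ≡ false) →
  ∣ p ∪ q ∣ ≡ ∣ p ∣ +ℕ ∣ q ∣
∣∪∣-disjoint []      []      _        = refl
∣∪∣-disjoint (x ∷ p) (y ∷ q) disjoint with x | y | disjoint zero
... | true  | true  | ()
... | true  | false | _ = cong suc (∣∪∣-disjoint p q (λ z → disjoint (suc z)))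
... | false | true  | _ = trans (cong suc (∣∪∣-disjoint p q (λ z → disjoint (suc z)))) (sym (+-suc ∣ p ∣ ∣ q ∣))
... | false | false | _ = ∣∪∣-disjoint p q (λ z → disjoint (suc z))

module Adjacency {n} (G : Graph n) where

  row : Fin n → Subset n
  row a = tabulate (adj G a)

  adjacentToList : List (Fin n) → Fin n → Bool
  adjacentToList as z = lookup (⋃ (map row as)) z

  adjacentTo : Subset n → Fin n → Bool
  adjacentTo W = adjacentToList (elems W)

  elems-complete : ∀ {W : Subset n} {a} → lookup W a ≡ true → a ∈ˡ elems W
  elems-complete {W} {a} a∈W = ∈-filter⁺ (_∈? W) (∈-allFin a) (lookup⇒[]= a W a∈W)

  elems-sound : ∀ {W : Subset n} {a} → a ∈ˡ elems W → lookup W a ≡ true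
  elems-sound {W} a∈ = []=⇒lookup (proj₂ (∈-filter⁻ (_∈? W) {xs = allFin n} a∈))

  adjacentToList-intro : ∀ as a z → a ∈ˡ as → adj G a z ≡ true → adjacentToList as z ≡ true
  adjacentToList-intro (b ∷ as) a z (here refl) a~z
    rewrite lookup-∪ (row a) (⋃ (map row as)) z | lookup∘tabulate (adj G a) z | a~z = refl
  adjacentToList-intro (b ∷ as) a z (there a∈as) a~z
    rewrite lookup-∪ (row b) (⋃ (map row as)) z | adjacentToList-intro as a z a∈as a~z
    = ∨-zeroʳ (lookup (row b) z)

  adjacentToList-elim : ∀ as z → adjacentToList as z ≡ true →
    Σ[ a ∈ Fin n ] a ∈ˡ as × adj G a z ≡ true
  adjacentToList-elim []       z hit = ⊥-elim (true≢false (trans (sym hit) (lookup-⊥ z)))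
  adjacentToList-elim (b ∷ as) z hit
    rewrite lookup-∪ (row b) (⋃ (map row as)) z | lookup∘tabulate (adj G b) z
    with adj G b z in b~z
  ... | true  = b , here refl , b~z
  ... | false with adjacentToList-elim as z hit
  ...   | a , a∈as , a~z = a , there a∈as , a~z

  adjacentTo-intro : ∀ W a z → lookup W a ≡ true → adj G a z ≡ true → adjacentTo W z ≡ true
  adjacentTo-intro W a z a∈W = adjacentToList-intro (elems W) a z (elems-complete a∈W)

  adjacentTo-elim : ∀ W z → adjacentTo W z ≡ true →
    Σ[ a ∈ Fin n ] lookup W a ≡ true × adj G a z ≡ true
  adjacentTo-elim W z hit with adjacentToList-elim (elems W) z hit
  ... | a , a∈W , a~z = a , elems-sound a∈W , a~z

  adjacentTo-insert : ∀ W a z → adjacentTo (W [ a ]≔ inside) z ≡ adjacentTo W z ∨ adj G a z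
  adjacentTo-insert W a z = ⇔→≡ {z = true} (mk⇔ to from)
    where
    to : adjacentTo (W [ a ]≔ inside) z ≡ true → adjacentTo W z ∨ adj G a z ≡ true
    to hit with adjacentTo-elim (W [ a ]≔ inside) z hit
    ... | b , b∈W+a , b~z with b ≟ a
    ...   | yes refl = trans (cong (adjacentTo W z ∨_) b~z) (∨-zeroʳ (adjacentTo W z))
    ...   | no  b≢a  =
      cong (_∨ adj G a z) (adjacentTo-intro W b z (trans (sym (lookup∘update′ b≢a W inside)) b∈W+a) b~z)
    from : adjacentTo W z ∨ adj G a z ≡ true → adjacentTo (W [ a ]≔ inside) z ≡ true
    from hit with adjacentTo W z in W-hit
    ... | false = adjacentTo-intro (W [ a ]≔ inside) a z (lookup∘update a W inside) hit
    ... | true with adjacentTo-elim W z W-hit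
    ...   | b , b∈W , b~z with b ≟ a
    ...     | yes refl = adjacentTo-intro (W [ a ]≔ inside) a z (lookup∘update a W inside) b~z
    ...     | no  b≢a  =
      adjacentTo-intro (W [ a ]≔ inside) b z (trans (lookup∘update′ b≢a W inside) b∈W) b~z

  adjacentTo-⁅⁆ : ∀ a z → adjacentTo ⁅ a ⁆ z ≡ adj G a z
  adjacentTo-⁅⁆ a z = ⇔→≡ {z = true} (mk⇔ to from)
    where
    to : adjacentTo ⁅ a ⁆ z ≡ true → adj G a z ≡ true
    to hit with adjacentTo-elim ⁅ a ⁆ z hit
    ... | b , b∈a , b~z with lookup-⁅⁆-member a b b∈a
    ...   | refl = b~z
    from : adj G a z ≡ true → adjacentTo ⁅ a ⁆ z ≡ true
    from = adjacentTo-intro ⁅ a ⁆ a z (lookup-⁅⁆-self a)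

  lookup-nbhd : ∀ S a z → lookup (nbhd G S a) z ≡ adj G a z ∧ lookup S z
  lookup-nbhd S a z rewrite lookup-∩ (row a) S z | lookup∘tabulate (adj G a) z = refl

  lookup-⋃nbhd : ∀ S as z →
    lookup (⋃ (map (nbhd G S) as)) z ≡ adjacentToList as z ∧ lookup S z
  lookup-⋃nbhd S []       z rewrite lookup-⊥ {n} z = refl
  lookup-⋃nbhd S (b ∷ as) z
    rewrite lookup-∪ (nbhd G S b) (⋃ (map (nbhd G S) as)) z | lookup-∪ (row b) (⋃ (map row as)) z
          | lookup-nbhd S b z | lookup-⋃nbhd S as z | lookup∘tabulate (adj G b) z
    with adj G b z | adjacentToList as z | lookup S z
  ... | true  | _     | true  = refl
  ... | true  | w     | false = ∧-zeroʳ w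
  ... | false | _     | _     = refl

  lookup-open : ∀ S W z →
    lookup (openNbhdSet G S W) z ≡ not (lookup W z) ∧ (adjacentTo W z ∧ lookup S z)
  lookup-open S W z
    rewrite lookup-─ (closedNbhdSet G S W) W z | lookup-∪ W (⋃ (map (nbhd G S) (elems W))) z
          | lookup-⋃nbhd S (elems W) z
    with lookup W z
  ... | true  = refl
  ... | false = ∧-identityʳ _

  lookup-closedNbhd : ∀ a z → lookup (closedNbhd G ⊤ a) z ≡ lookup ⁅ a ⁆ z ∨ adj G a z
  lookup-closedNbhd a z
    rewrite lookup-∪ ⁅ a ⁆ (⋃ (map (nbhd G ⊤) (elems ⁅ a ⁆))) z
          | lookup-⋃nbhd ⊤ (elems ⁅ a ⁆) z | lookup-⊤ z | adjacentTo-⁅⁆ a z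
          | ∧-identityʳ (adj G a z) = refl

module SubsetSums {c ℓ : Level} (R : CommutativeRing c ℓ) where
  open CommutativeRing R renaming (refl to ≈-refl; sym to ≈-sym; trans to ≈-trans)
  open import Relation.Binary.Reasoning.Setoid setoid
  open import Algebra.Properties.AbelianGroup +-abelianGroup using (⁻¹-∙-comm)
  open import Algebra.Solver.Ring.NaturalCoefficients.Default commutativeSemiring
    using (solve; _:=_; _:+_)

  ΣS : ∀ n → (Subset n → Carrier) → Carrier
  ΣS zero    f = f []
  ΣS (suc n) f = ΣS n (λ W → f (inside ∷ W)) + ΣS n (λ W → f (outside ∷ W))

  ΣS-cong : ∀ n {f g : Subset n → Carrier} → (∀ W → f W ≈ g W) → ΣS n f ≈ ΣS n g
  ΣS-cong zero    f≈g = f≈g []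
  ΣS-cong (suc n) f≈g = +-cong (ΣS-cong n (λ W → f≈g _)) (ΣS-cong n (λ W → f≈g _))

  ΣS-0 : ∀ n → ΣS n (λ _ → 0#) ≈ 0#
  ΣS-0 zero    = ≈-refl
  ΣS-0 (suc n) = ≈-trans (+-cong (ΣS-0 n) (ΣS-0 n)) (+-identityˡ 0#)

  ΣS-+ : ∀ n (f g : Subset n → Carrier) → ΣS n (λ W → f W + g W) ≈ ΣS n f + ΣS n g
  ΣS-+ zero    f g = ≈-refl
  ΣS-+ (suc n) f g = ≈-trans (+-cong (ΣS-+ n _ _) (ΣS-+ n _ _)) (interchange _ _ _ _)
    where
    interchange : ∀ a b c d → (a + b) + (c + d) ≈ (a + c) + (b + d)
    interchange = solve 4 (λ a b c d → (a :+ b) :+ (c :+ d) := (a :+ c) :+ (b :+ d)) ≈-refl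

  ΣS-* : ∀ n a (f : Subset n → Carrier) → ΣS n (λ W → a * f W) ≈ a * ΣS n f
  ΣS-* zero    a f = ≈-refl
  ΣS-* (suc n) a f = ≈-trans (+-cong (ΣS-* n a _) (ΣS-* n a _)) (≈-sym (distribˡ a _ _))

  ΣS-neg : ∀ n (f : Subset n → Carrier) → ΣS n (λ W → - f W) ≈ - ΣS n f
  ΣS-neg zero    f = ≈-refl
  ΣS-neg (suc n) f = ≈-trans (+-cong (ΣS-neg n _) (ΣS-neg n _)) (⁻¹-∙-comm _ _)

  ΣS-- : ∀ n (f g : Subset n → Carrier) → ΣS n (λ W → f W - g W) ≈ ΣS n f - ΣS n g
  ΣS-- n f g = ≈-trans (ΣS-+ n f (λ W → - g W)) (+-congˡ (ΣS-neg n g))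

  ΣS-linear : ∀ n α β γ (f g h : Subset n → Carrier) →
    ΣS n (λ W → α * f W - β * g W - γ * h W) ≈ α * ΣS n f - β * ΣS n g - γ * ΣS n h
  ΣS-linear n α β γ f g h = begin
    ΣS n (λ W → α * f W - β * g W - γ * h W)
      ≈⟨ ΣS-- n _ _ ⟩
    ΣS n (λ W → α * f W - β * g W) - ΣS n (λ W → γ * h W)
      ≈⟨ +-cong (ΣS-- n _ _) (-‿cong (ΣS-* n γ h)) ⟩
    ΣS n (λ W → α * f W) - ΣS n (λ W → β * g W) - γ * ΣS n h
      ≈⟨ +-congʳ (+-cong (ΣS-* n α f) (-‿cong (ΣS-* n β g))) ⟩
    α * ΣS n f - β * ΣS n g - γ * ΣS n h ∎

  -- Each subset W is either W with a removed or W with a added.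
  split-at : ∀ n (a : Fin n) (f : Subset n → Carrier) →
    ΣS n f ≈ ΣS n (λ W → if lookup W a then 0# else f W + f (W [ a ]≔ inside))
  split-at (suc n) zero f = begin
    ΣS n (λ W → f (inside ∷ W)) + ΣS n (λ W → f (outside ∷ W))
      ≈⟨ +-comm _ _ ⟩
    ΣS n (λ W → f (outside ∷ W)) + ΣS n (λ W → f (inside ∷ W))
      ≈⟨ ≈-sym (ΣS-+ n _ _) ⟩
    ΣS n (λ W → f (outside ∷ W) + f (inside ∷ W))
      ≈⟨ ≈-sym (+-identityˡ _) ⟩
    0# + ΣS n (λ W → f (outside ∷ W) + f (inside ∷ W))
      ≈⟨ +-congʳ (≈-sym (ΣS-0 n)) ⟩
    ΣS n (λ _ → 0#) + ΣS n (λ W → f (outside ∷ W) + f (inside ∷ W)) ∎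
  split-at (suc n) (suc a) f = +-cong (split-at n a _) (split-at n a _)

  quadruple : ∀ {n} (a b : Fin n) → (Subset n → Carrier) → Subset n → Carrier
  quadruple a b f W =
    (f W + f (W [ b ]≔ inside)) + (f (W [ a ]≔ inside) + f (W [ a ]≔ inside [ b ]≔ inside))

  grouped : ∀ {n} (a b : Fin n) → (Subset n → Carrier) → Subset n → Carrier
  grouped a b f W = if lookup W a ∨ lookup W b then 0# else quadruple a b f W

  split-at-two : ∀ n {a b : Fin n} → a ≢ b → (f : Subset n → Carrier) →
    ΣS n f ≈ ΣS n (grouped a b f)
  split-at-two n {a} {b} a≢b f =
    ≈-trans (split-at n b f) (≈-trans (split-at n a _) (ΣS-cong n regroup))
    where
    regroup : ∀ W →
      (if lookup W a then 0#
       else ((if lookup W b then 0# else f W + f (W [ b ]≔ inside))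
          + (if lookup (W [ a ]≔ inside) b then 0#
             else f (W [ a ]≔ inside) + f (W [ a ]≔ inside [ b ]≔ inside))))
      ≈ grouped a b f W
    regroup W rewrite lookup∘update′ (λ b≡a → a≢b (sym b≡a)) W inside with lookup W a | lookup W b
    ... | true  | _     = ≈-refl
    ... | false | true  = +-identityˡ 0#
    ... | false | false = ≈-refl

  sumR-++ : ∀ xs ys → sumR R (xs ++ ys) ≈ sumR R xs + sumR R ys
  sumR-++ []       ys = ≈-sym (+-identityˡ _)
  sumR-++ (x ∷ xs) ys = ≈-trans (+-congˡ (sumR-++ xs ys)) (≈-sym (+-assoc _ _ _))

  sumR-filter : ∀ {A : Set} {P : Pred A 0ℓ} (P? : Decidable P) (f : A → Carrier) xs →
    sumR R (map f (filter P? xs)) ≈ sumR R (map (λ a → if does (P? a) then f a else 0#) xs)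
  sumR-filter P? f [] = ≈-refl
  sumR-filter P? f (x ∷ xs) with does (P? x)
  ... | true  = +-congˡ (sumR-filter P? f xs)
  ... | false = ≈-trans (sumR-filter P? f xs) (≈-sym (+-identityˡ _))

  sumR-allSubsets : ∀ n (f : Subset n → Carrier) → sumR R (map f (allSubsets n)) ≈ ΣS n f
  sumR-allSubsets zero    f = +-identityʳ _
  sumR-allSubsets (suc n) f = begin
    sumR R (map f (map (inside ∷_) A ++ map (outside ∷_) A))
      ≡⟨ cong (sumR R) (map-++ f (map (inside ∷_) A) (map (outside ∷_) A)) ⟩
    sumR R (map f (map (inside ∷_) A) ++ map f (map (outside ∷_) A))
      ≈⟨ sumR-++ (map f (map (inside ∷_) A)) (map f (map (outside ∷_) A)) ⟩
    sumR R (map f (map (inside ∷_) A)) + sumR R (map f (map (outside ∷_) A))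
      ≡⟨ cong₂ (λ s t → sumR R s + sumR R t) (sym (map-∘ A)) (sym (map-∘ A)) ⟩
    sumR R (map (λ W → f (inside ∷ W)) A) + sumR R (map (λ W → f (outside ∷ W)) A)
      ≈⟨ +-cong (sumR-allSubsets n _) (sumR-allSubsets n _) ⟩
    ΣS (suc n) f ∎
    where A = allSubsets n

  domTerm : ∀ {n} → Graph n → Subset n → Carrier → Carrier → Subset n → Carrier
  domTerm G S x y W =
    if does (W ⊆? S) then pow R x ∣ W ∣ * pow R y ∣ openNbhdSet G S W ∣ else 0#

  J-as-ΣS : ∀ {n} (G : Graph n) (S : Subset n) x y → J R G S x y ≈ ΣS n (domTerm G S x y)
  J-as-ΣS {n} G S x y = ≈-trans (sumR-filter (_⊆? S) _ (allSubsets n)) (sumR-allSubsets n _)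

module TwinVertices {n} (G : Graph n) (u v : Fin n)
  (u~v : u ~[ G ] v)
  (twins : nbhd G (⊤ ─ ⁅ v ⁆) u ≡ nbhd G (⊤ ─ ⁅ u ⁆) v)
  (L-clique : ∀ a b → a ∈ nbhd G (⊤ ─ ⁅ v ⁆) u → b ∈ nbhd G (⊤ ─ ⁅ v ⁆) u → a ≢ b → a ~[ G ] b)
  where

  open Adjacency G

  V∖v V∖vu V∖N[u] : Subset n
  V∖v    = ⊤ ─ ⁅ v ⁆
  V∖vu   = ⊤ ─ ⁅ v ⁆ ─ ⁅ u ⁆
  V∖N[u] = ⊤ ─ closedNbhd G ⊤ u

  L : Subset n
  L = nbhd G V∖vu u

  u≢v : u ≢ v
  u≢v refl = true≢false (trans (sym u~v) (irrefl G u))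

  v≢u : v ≢ u
  v≢u v≡u = u≢v (sym v≡u)

  v~u : v ~[ G ] u
  v~u = trans (Graph.sym G v u) u~v

  ∈V∖v : ∀ z → z ≢ v → lookup V∖v z ≡ true
  ∈V∖v z z≢v rewrite lookup-⊤─ ⁅ v ⁆ z | lookup-⁅⁆-other v z z≢v = refl

  v∉V∖v : lookup V∖v v ≡ false
  v∉V∖v rewrite lookup-⊤─ ⁅ v ⁆ v | lookup-⁅⁆-self v = refl

  lookup-V∖vu : ∀ z → lookup V∖vu z ≡ lookup V∖v z ∧ not (lookup ⁅ u ⁆ z)
  lookup-V∖vu z = lookup-─ V∖v ⁅ u ⁆ z

  ∈V∖vu : ∀ z → z ≢ u → z ≢ v → lookup V∖vu z ≡ true
  ∈V∖vu z z≢u z≢v rewrite lookup-V∖vu z | ∈V∖v z z≢v | lookup-⁅⁆-other u z z≢u = refl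

  u∉V∖vu : lookup V∖vu u ≡ false
  u∉V∖vu rewrite lookup-V∖vu u | lookup-⁅⁆-self u = ∧-zeroʳ _

  v∉V∖vu : lookup V∖vu v ≡ false
  v∉V∖vu rewrite lookup-V∖vu v | v∉V∖v = refl

  lookup-V∖N[u] : ∀ z → lookup V∖N[u] z ≡ not (lookup ⁅ u ⁆ z ∨ adj G u z)
  lookup-V∖N[u] z rewrite lookup-⊤─ (closedNbhd G ⊤ u) z | lookup-closedNbhd u z = refl

  u∉V∖N[u] : lookup V∖N[u] u ≡ false
  u∉V∖N[u] rewrite lookup-V∖N[u] u | lookup-⁅⁆-self u = refl

  N[u]∉V∖N[u] : ∀ z → adj G u z ≡ true → lookup V∖N[u] z ≡ false
  N[u]∉V∖N[u] z u~z rewrite lookup-V∖N[u] z | u~z | ∨-zeroʳ (lookup ⁅ u ⁆ z) = refl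

  twin-adj : ∀ z → z ≢ u → z ≢ v → adj G v z ≡ adj G u z
  twin-adj z z≢u z≢v = begin
    adj G v z                               ≡⟨ sym (∧-identityʳ _) ⟩
    adj G v z ∧ true                        ≡⟨ cong (adj G v z ∧_) (sym z∈V∖u) ⟩
    adj G v z ∧ lookup (⊤ ─ ⁅ u ⁆) z        ≡⟨ sym (lookup-nbhd (⊤ ─ ⁅ u ⁆) v z) ⟩
    lookup (nbhd G (⊤ ─ ⁅ u ⁆) v) z         ≡⟨ cong (λ N → lookup N z) (sym twins) ⟩
    lookup (nbhd G V∖v u) z                 ≡⟨ lookup-nbhd V∖v u z ⟩
    adj G u z ∧ lookup V∖v z                ≡⟨ cong (adj G u z ∧_) (∈V∖v z z≢v) ⟩
    adj G u z ∧ true                        ≡⟨ ∧-identityʳ _ ⟩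
    adj G u z                               ∎
    where
    open ≡-Reasoning
    z∈V∖u : lookup (⊤ ─ ⁅ u ⁆) z ≡ true
    z∈V∖u rewrite lookup-⊤─ ⁅ u ⁆ z | lookup-⁅⁆-other u z z≢u = refl

  clique : ∀ a b → adj G u a ≡ true → a ≢ v → adj G u b ≡ true → b ≢ v → a ≢ b → adj G a b ≡ true
  clique a b u~a a≢v u~b b≢v =
    L-clique a b (lookup⇒[]= a _ (in-L u~a a≢v)) (lookup⇒[]= b _ (in-L u~b b≢v))
    where
    in-L : ∀ {z} → adj G u z ≡ true → z ≢ v → lookup (nbhd G V∖v u) z ≡ true
    in-L {z} u~z z≢v rewrite lookup-nbhd V∖v u z | u~z | ∈V∖v z z≢v = refl

  u∉L : lookup L u ≡ false
  u∉L rewrite lookup-nbhd V∖vu u u | u∉V∖vu = ∧-zeroʳ _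

  v∉L : lookup L v ≡ false
  v∉L rewrite lookup-nbhd V∖vu u v | v∉V∖vu = ∧-zeroʳ _

  -- |N(u)| - 1 = |L|: the neighbours of u are v and the vertices of L.
  ∣L∣ : ∣ nbhd G ⊤ u ∣ ∸ 1 ≡ ∣ L ∣
  ∣L∣ = cong (_∸ 1) (trans (∣∣-outside-two u≢v (nbhd G ⊤ u) L u∉L v∉L agree) bits)
    where
    agree : ∀ z → z ≢ u → z ≢ v → lookup (nbhd G ⊤ u) z ≡ lookup L z
    agree z z≢u z≢v
      rewrite lookup-nbhd ⊤ u z | lookup-nbhd V∖vu u z | lookup-⊤ z | ∈V∖vu z z≢u z≢v = refl
    bits : ind (lookup (nbhd G ⊤ u) u) +ℕ (ind (lookup (nbhd G ⊤ u) v) +ℕ ∣ L ∣) ≡ suc ∣ L ∣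
    bits rewrite lookup-nbhd ⊤ u u | lookup-nbhd ⊤ u v | irrefl G u | u~v | lookup-⊤ v = refl

  ext-off-uv : ∀ {p q : Subset n} → lookup p u ≡ lookup q u → lookup p v ≡ lookup q v →
    (∀ z → z ≢ u → z ≢ v → lookup p z ≡ lookup q z) → p ≡ q
  ext-off-uv {p} {q} at-u at-v elsewhere = subset-ext pointwise
    where
    pointwise : ∀ z → lookup p z ≡ lookup q z
    pointwise z with z ≟ u | z ≟ v
    ... | yes refl | _        = at-u
    ... | no _     | yes refl = at-v
    ... | no z≢u   | no z≢v   = elsewhere z z≢u z≢v

  twin-adj′ : ∀ a → a ≢ u → a ≢ v → adj G a v ≡ adj G a u
  twin-adj′ a a≢u a≢v = trans (Graph.sym G a v) (trans (twin-adj a a≢u a≢v) (Graph.sym G u a))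

  twin-adjacentTo : ∀ W → lookup W u ≡ false → lookup W v ≡ false →
    adjacentTo W v ≡ adjacentTo W u
  twin-adjacentTo W u∉W v∉W = ⇔→≡ {z = true} (mk⇔ to from)
    where
    twin-at : ∀ {a} → lookup W a ≡ true → adj G a v ≡ adj G a u
    twin-at {a} a∈W = twin-adj′ a (≢-by-membership W a∈W u∉W) (≢-by-membership W a∈W v∉W)
    to : adjacentTo W v ≡ true → adjacentTo W u ≡ true
    to hit with adjacentTo-elim W v hit
    ... | a , a∈W , a~v = adjacentTo-intro W a u a∈W (trans (sym (twin-at a∈W)) a~v)
    from : adjacentTo W u ≡ true → adjacentTo W v ≡ true
    from hit with adjacentTo-elim W u hit
    ... | a , a∈W , a~u = adjacentTo-intro W a v a∈W (trans (twin-at a∈W) a~u)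

  module Quadruple (W : Subset n) (u∉W : lookup W u ≡ false) (v∉W : lookup W v ≡ false) where

    Wu Wv Wuv : Subset n
    Wu  = W [ u ]≔ inside
    Wv  = W [ v ]≔ inside
    Wuv = Wu [ v ]≔ inside

    ∣Wu∣ : ∣ Wu ∣ ≡ suc ∣ W ∣
    ∣Wu∣ = ∣∣-update W u inside u∉W

    ∣Wv∣ : ∣ Wv ∣ ≡ suc ∣ W ∣
    ∣Wv∣ = ∣∣-update W v inside v∉W

    v∉Wu : lookup Wu v ≡ false
    v∉Wu = trans (lookup∘update′ v≢u W inside) v∉W

    ∣Wuv∣ : ∣ Wuv ∣ ≡ suc (suc ∣ W ∣)
    ∣Wuv∣ = trans (∣∣-update Wu v inside v∉Wu) (cong suc ∣Wu∣)

    N : Subset n → Subset n → Subset n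
    N S W′ = openNbhdSet G S W′

    core : Subset n → Subset n
    core W′ = N V∖vu W′

    core-off-uv : ∀ W′ z → z ≢ u → z ≢ v → lookup (core W′) z ≡ not (lookup W′ z) ∧ adjacentTo W′ z
    core-off-uv W′ z z≢u z≢v
      rewrite lookup-open V∖vu W′ z | ∈V∖vu z z≢u z≢v | ∧-identityʳ (adjacentTo W′ z) = refl

    core-avoids : ∀ W′ z → lookup V∖vu z ≡ false → lookup (core W′) z ≡ false
    core-avoids W′ z z∉ rewrite lookup-open V∖vu W′ z | z∉ | ∧-zeroʳ (adjacentTo W′ z) = ∧-zeroʳ _

    core-ext : ∀ W₁ W₂ → (∀ z → z ≢ u → z ≢ v → lookup (core W₁) z ≡ lookup (core W₂) z) →
      core W₁ ≡ core W₂
    core-ext W₁ W₂ = ext-off-uv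
      (trans (core-avoids W₁ u u∉V∖vu) (sym (core-avoids W₂ u u∉V∖vu)))
      (trans (core-avoids W₁ v v∉V∖vu) (sym (core-avoids W₂ v v∉V∖vu)))

    size-via-core : ∀ S W′ → (∀ z → z ≢ u → z ≢ v → lookup S z ≡ true) →
      ∣ N S W′ ∣ ≡ ind (lookup (N S W′) u) +ℕ (ind (lookup (N S W′) v) +ℕ ∣ core W′ ∣)
    size-via-core S W′ S-full = ∣∣-outside-two u≢v (N S W′) (core W′)
      (core-avoids W′ u u∉V∖vu) (core-avoids W′ v v∉V∖vu) agree
      where
      agree : ∀ z → z ≢ u → z ≢ v → lookup (N S W′) z ≡ lookup (core W′) z
      agree z z≢u z≢v
        rewrite lookup-open S W′ z | lookup-open V∖vu W′ z | S-full z z≢u z≢v | ∈V∖vu z z≢u z≢v = refl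

    ⊤-full : ∀ z → z ≢ u → z ≢ v → lookup ⊤ z ≡ true
    ⊤-full z _ _ = lookup-⊤ z

    V∖v-full : ∀ z → z ≢ u → z ≢ v → lookup V∖v z ≡ true
    V∖v-full z _ z≢v = ∈V∖v z z≢v

    lookup-Wu : ∀ z → z ≢ u → lookup Wu z ≡ lookup W z
    lookup-Wu z z≢u = lookup∘update′ z≢u W inside

    adjacentTo-Wu : ∀ z → adjacentTo Wu z ≡ adjacentTo W z ∨ adj G u z
    adjacentTo-Wu = adjacentTo-insert W u

    core-Wv : core Wv ≡ core Wu
    core-Wv = core-ext Wv Wu agree
      where
      agree : ∀ z → z ≢ u → z ≢ v → lookup (core Wv) z ≡ lookup (core Wu) z
      agree z z≢u z≢v
        rewrite core-off-uv Wv z z≢u z≢v | core-off-uv Wu z z≢u z≢v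
              | lookup∘update′ z≢v W inside | lookup-Wu z z≢u
              | adjacentTo-insert W v z | adjacentTo-Wu z | twin-adj z z≢u z≢v = refl

    core-Wuv : core Wuv ≡ core Wu
    core-Wuv = core-ext Wuv Wu agree
      where
      agree : ∀ z → z ≢ u → z ≢ v → lookup (core Wuv) z ≡ lookup (core Wu) z
      agree z z≢u z≢v
        rewrite core-off-uv Wuv z z≢u z≢v | core-off-uv Wu z z≢u z≢v
              | lookup∘update′ z≢v Wu inside | adjacentTo-insert Wu v z | adjacentTo-Wu z
              | twin-adj z z≢u z≢v
        with lookup Wu z | adjacentTo W z | adj G u z
      ... | true  | _     | _     = refl
      ... | false | true  | _     = refl
      ... | false | false | true  = refl
      ... | false | false | false = refl

    h : Bool
    h = adjacentTo W u

    size-W : ∣ N ⊤ W ∣ ≡ ind h +ℕ (ind h +ℕ ∣ core W ∣)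
    size-W rewrite size-via-core ⊤ W ⊤-full | lookup-open ⊤ W u | lookup-open ⊤ W v
                 | u∉W | v∉W | lookup-⊤ u | lookup-⊤ v | twin-adjacentTo W u∉W v∉W
                 | ∧-identityʳ h = refl

    size-Wu : ∣ N ⊤ Wu ∣ ≡ suc ∣ core Wu ∣
    size-Wu rewrite size-via-core ⊤ Wu ⊤-full | lookup-open ⊤ Wu u | lookup-open ⊤ Wu v
                  | lookup∘update u W inside | v∉Wu | adjacentTo-Wu v | u~v | lookup-⊤ v
                  | ∨-zeroʳ (adjacentTo W v) = refl

    size-Wv : ∣ N ⊤ Wv ∣ ≡ suc ∣ core Wu ∣
    size-Wv rewrite size-via-core ⊤ Wv ⊤-full | lookup-open ⊤ Wv u | lookup-open ⊤ Wv v
                  | lookup∘update v W inside | lookup∘update′ u≢v W inside | u∉W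
                  | adjacentTo-insert W v u | v~u | lookup-⊤ u
                  | ∨-zeroʳ (adjacentTo W u) | core-Wv = refl

    size-Wuv : ∣ N ⊤ Wuv ∣ ≡ ∣ core Wu ∣
    size-Wuv rewrite size-via-core ⊤ Wuv ⊤-full | lookup-open ⊤ Wuv u | lookup-open ⊤ Wuv v
                   | lookup∘update v Wu inside | lookup∘update′ u≢v Wu inside
                   | lookup∘update u W inside | core-Wuv = refl

    size-V∖v-W : ∣ N V∖v W ∣ ≡ ind h +ℕ ∣ core W ∣
    size-V∖v-W rewrite size-via-core V∖v W V∖v-full | lookup-open V∖v W u | lookup-open V∖v W v
                     | u∉W | v∉W | v∉V∖v | ∈V∖v u u≢v | ∧-identityʳ h | ∧-zeroʳ (adjacentTo W v) = refl

    size-V∖v-Wu : ∣ N V∖v Wu ∣ ≡ ∣ core Wu ∣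
    size-V∖v-Wu rewrite size-via-core V∖v Wu V∖v-full | lookup-open V∖v Wu u | lookup-open V∖v Wu v
                      | lookup∘update u W inside | v∉Wu | v∉V∖v | ∧-zeroʳ (adjacentTo Wu v) = refl

    ⊆⊤ : ∀ (W′ : Subset n) → does (W′ ⊆? ⊤) ≡ true
    ⊆⊤ W′ = ⊆?-true W′ ⊤ (λ z _ → lookup-⊤ z)

    W⊆V∖v : does (W ⊆? V∖v) ≡ true
    W⊆V∖v = ⊆?-true W V∖v (λ z z∈W → ∈V∖v z (≢-by-membership W z∈W v∉W))

    Wu⊆V∖v : does (Wu ⊆? V∖v) ≡ true
    Wu⊆V∖v = ⊆?-true Wu V∖v in-V∖v
      where
      in-V∖v : ∀ z → lookup Wu z ≡ true → lookup V∖v z ≡ true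
      in-V∖v z z∈Wu with z ≟ u
      ... | yes refl = ∈V∖v u u≢v
      ... | no  z≢u  = ∈V∖v z (≢-by-membership Wu z∈Wu v∉Wu)

    W⊆V∖vu : does (W ⊆? V∖vu) ≡ true
    W⊆V∖vu = ⊆?-true W V∖vu
      (λ z z∈W → ∈V∖vu z (≢-by-membership W z∈W u∉W) (≢-by-membership W z∈W v∉W))

    u∈Wu : lookup Wu u ≡ true
    u∈Wu = lookup∘update u W inside

    v∈Wv : lookup Wv v ≡ true
    v∈Wv = lookup∘update v W inside

    v∈Wuv : lookup Wuv v ≡ true
    v∈Wuv = lookup∘update v Wu inside

    v∉V∖N[u] : lookup V∖N[u] v ≡ false
    v∉V∖N[u] = N[u]∉V∖N[u] v u~v

    Wv⊄V∖v : does (Wv ⊆? V∖v) ≡ false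
    Wv⊄V∖v = ⊆?-false Wv V∖v v v∈Wv v∉V∖v

    Wuv⊄V∖v : does (Wuv ⊆? V∖v) ≡ false
    Wuv⊄V∖v = ⊆?-false Wuv V∖v v v∈Wuv v∉V∖v

    Wu⊄V∖vu : does (Wu ⊆? V∖vu) ≡ false
    Wu⊄V∖vu = ⊆?-false Wu V∖vu u u∈Wu u∉V∖vu

    Wv⊄V∖vu : does (Wv ⊆? V∖vu) ≡ false
    Wv⊄V∖vu = ⊆?-false Wv V∖vu v v∈Wv v∉V∖vu

    Wuv⊄V∖vu : does (Wuv ⊆? V∖vu) ≡ false
    Wuv⊄V∖vu = ⊆?-false Wuv V∖vu v v∈Wuv v∉V∖vu

    Wu⊄V∖N[u] : does (Wu ⊆? V∖N[u]) ≡ false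
    Wu⊄V∖N[u] = ⊆?-false Wu V∖N[u] u u∈Wu u∉V∖N[u]

    Wv⊄V∖N[u] : does (Wv ⊆? V∖N[u]) ≡ false
    Wv⊄V∖N[u] = ⊆?-false Wv V∖N[u] v v∈Wv v∉V∖N[u]

    Wuv⊄V∖N[u] : does (Wuv ⊆? V∖N[u]) ≡ false
    Wuv⊄V∖N[u] = ⊆?-false Wuv V∖N[u] v v∈Wuv v∉V∖N[u]

    -- If W dominates u, it dominates v and all of L, so both cores coincide.
    module Dominated (hit : adjacentTo W u ≡ true) where

      W⊄V∖N[u] : does (W ⊆? V∖N[u]) ≡ false
      W⊄V∖N[u] with adjacentTo-elim W u hit
      ... | a , a∈W , a~u = ⊆?-false W V∖N[u] a a∈W (N[u]∉V∖N[u] a (trans (Graph.sym G u a) a~u))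

      ∣N-W∣ : ∣ N ⊤ W ∣ ≡ suc (suc ∣ core W ∣)
      ∣N-W∣ = trans size-W (cong (λ b → ind b +ℕ (ind b +ℕ ∣ core W ∣)) hit)

      ∣N-v-W∣ : ∣ N V∖v W ∣ ≡ suc ∣ core W ∣
      ∣N-v-W∣ = trans size-V∖v-W (cong (λ b → ind b +ℕ ∣ core W ∣) hit)

      core-Wu : core Wu ≡ core W
      core-Wu = core-ext Wu W agree
        where
        agree : ∀ z → z ≢ u → z ≢ v → lookup (core Wu) z ≡ lookup (core W) z
        agree z z≢u z≢v with adjacentTo-elim W u hit
        ... | a , a∈W , a~u
          rewrite core-off-uv Wu z z≢u z≢v | core-off-uv W z z≢u z≢v | lookup-Wu z z≢u | adjacentTo-Wu z
          with lookup W z in z∈W? | adjacentTo W z in W~z? | adj G u z in u~z?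
        ... | true  | _     | _     = refl
        ... | false | true  | _     = refl
        ... | false | false | false = refl
        ... | false | false | true  = ⊥-elim (true≢false (trans (sym W~z) W~z?))
          where
          a≢z : a ≢ z
          a≢z = ≢-by-membership W a∈W z∈W?
          u~a : adj G u a ≡ true
          u~a = trans (Graph.sym G u a) a~u
          a~z : adj G a z ≡ true
          a~z = clique a z u~a (≢-by-membership W a∈W v∉W) u~z? z≢v a≢z
          W~z : adjacentTo W z ≡ true
          W~z = adjacentTo-intro W a z a∈W a~z

    -- If W does not dominate u, then W ⊆ V - N[u], and the common core of W+u,
    -- W+v, W+u+v is N_{G-N[u]}(W) together with L.
    module Undominated (miss : adjacentTo W u ≡ false) where

      ¬u~W : ∀ z → lookup W z ≡ true → adj G u z ≡ false
      ¬u~W z z∈W with adj G u z in u~z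
      ... | false = refl
      ... | true  = ⊥-elim (true≢false
        (trans (sym (adjacentTo-intro W z u z∈W (trans (Graph.sym G z u) u~z))) miss))

      W⊆V∖N[u] : does (W ⊆? V∖N[u]) ≡ true
      W⊆V∖N[u] = ⊆?-true W V∖N[u] in-V∖N[u]
        where
        in-V∖N[u] : ∀ z → lookup W z ≡ true → lookup V∖N[u] z ≡ true
        in-V∖N[u] z z∈W rewrite lookup-V∖N[u] z | lookup-⁅⁆-other u z (≢-by-membership W z∈W u∉W)
                               | ¬u~W z z∈W = refl

      M : Subset n
      M = N V∖N[u] W

      u∉M : lookup M u ≡ false
      u∉M rewrite lookup-open V∖N[u] W u | u∉V∖N[u] | ∧-zeroʳ (adjacentTo W u) = ∧-zeroʳ _

      v∉M : lookup M v ≡ false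
      v∉M rewrite lookup-open V∖N[u] W v | v∉V∖N[u] | ∧-zeroʳ (adjacentTo W v) = ∧-zeroʳ _

      core-Wu : core Wu ≡ M ∪ L
      core-Wu = ext-off-uv
        (trans (core-avoids Wu u u∉V∖vu) (sym (trans (lookup-∪ M L u) (cong₂ _∨_ u∉M u∉L))))
        (trans (core-avoids Wu v v∉V∖vu) (sym (trans (lookup-∪ M L v) (cong₂ _∨_ v∉M v∉L))))
        agree
        where
        agree : ∀ z → z ≢ u → z ≢ v → lookup (core Wu) z ≡ lookup (M ∪ L) z
        agree z z≢u z≢v
          rewrite core-off-uv Wu z z≢u z≢v | lookup-∪ M L z | lookup-open V∖N[u] W z
                | lookup-nbhd V∖vu u z | lookup-Wu z z≢u | adjacentTo-Wu z | lookup-V∖N[u] z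
                | lookup-⁅⁆-other u z z≢u | ∈V∖vu z z≢u z≢v
          with lookup W z in z∈W? | adjacentTo W z | adj G u z in u~z?
        ... | true  | _     | true  = ⊥-elim (true≢false (trans (sym u~z?) (¬u~W z z∈W?)))
        ... | true  | _     | false = refl
        ... | false | true  | true  = refl
        ... | false | true  | false = refl
        ... | false | false | true  = refl
        ... | false | false | false = refl

      M∩L=∅ : ∀ z → lookup M z ∧ lookup L z ≡ false
      M∩L=∅ z rewrite lookup-open V∖N[u] W z | lookup-nbhd V∖vu u z with adj G u z in u~z
      ... | false = ∧-zeroʳ _
      ... | true  rewrite N[u]∉V∖N[u] z u~z | ∧-zeroʳ (adjacentTo W z) | ∧-zeroʳ (not (lookup W z)) = refl

      ∣N-W∣ : ∣ N ⊤ W ∣ ≡ ∣ core W ∣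
      ∣N-W∣ = trans size-W (cong (λ b → ind b +ℕ (ind b +ℕ ∣ core W ∣)) miss)

      ∣N-v-W∣ : ∣ N V∖v W ∣ ≡ ∣ core W ∣
      ∣N-v-W∣ = trans size-V∖v-W (cong (λ b → ind b +ℕ ∣ core W ∣) miss)

      ∣core-Wu∣ : ∣ core Wu ∣ ≡ ∣ M ∣ +ℕ ∣ L ∣
      ∣core-Wu∣ = trans (cong ∣_∣ core-Wu) (∣∪∣-disjoint M L M∩L=∅)

module Recurrence {c ℓ : Level} (R : CommutativeRing c ℓ) {n} (G : Graph n) (u v : Fin n)
  (u~v : u ~[ G ] v)
  (twins : nbhd G (⊤ ─ ⁅ v ⁆) u ≡ nbhd G (⊤ ─ ⁅ u ⁆) v)
  (L-clique : ∀ a b → a ∈ nbhd G (⊤ ─ ⁅ v ⁆) u → b ∈ nbhd G (⊤ ─ ⁅ v ⁆) u → a ≢ b → a ~[ G ] b)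
  (x y : CommutativeRing.Carrier R)
  where

  open CommutativeRing R renaming (refl to ≈-refl; sym to ≈-sym; trans to ≈-trans)
  open import Relation.Binary.Reasoning.Setoid setoid
  open import Algebra.Properties.Group +-group using (//-rightDividesˡ; //-rightDividesʳ)
  open import Algebra.Solver.Ring.NaturalCoefficients.Default commutativeSemiring
    using (solve; _:=_; _:+_; _:*_; con)
  open SubsetSums R
  open TwinVertices G u v u~v twins L-clique
  open Adjacency G using (adjacentTo)

  l : Carrier
  l = pow R y (∣ nbhd G ⊤ u ∣ ∸ 1)

  rhs : Carrier → Carrier → Carrier → Carrier
  rhs b c d = (1# + x + y) * b - (x + y) * c - x * (1# - y) * l * d

  rhs-cong : ∀ {b b′ c c′ d d′} → b ≈ b′ → c ≈ c′ → d ≈ d′ → rhs b c d ≈ rhs b′ c′ d′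
  rhs-cong b≈ c≈ d≈ = +-cong (+-cong (*-congˡ b≈) (-‿cong (*-congˡ c≈))) (-‿cong (*-congˡ d≈))

  move : ∀ a p r → a + p ≈ r → a ≈ r - p
  move a p r a+p≈r = ≈-trans (≈-sym (//-rightDividesʳ p a)) (+-congʳ a+p≈r)

  cancel : ∀ p q t → p + t ≈ q + t → p ≈ q
  cancel p q t p+t≈q+t = ≈-trans (move p t (q + t) p+t≈q+t) (//-rightDividesʳ t q)

  x[1-y]+xy : ∀ D → x * (1# - y) * D + x * y * D ≈ x * D
  x[1-y]+xy D = begin
    x * (1# - y) * D + x * y * D ≈⟨ ≈-sym (distribʳ D _ _) ⟩
    (x * (1# - y) + x * y) * D   ≈⟨ *-congʳ (≈-sym (distribˡ x _ y)) ⟩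
    x * ((1# - y) + y) * D       ≈⟨ *-congʳ (*-congˡ (//-rightDividesˡ y 1#)) ⟩
    x * 1# * D                   ≈⟨ *-congʳ (*-identityʳ x) ⟩
    x * D                        ∎

  -- An identity a ≈ rhs b c d reduces to a subtraction-free one, where D = l·d.
  rhs-intro : ∀ a b c d D → l * d ≈ D →
    a + (x + y) * c + x * D ≈ (1# + x + y) * b + x * y * D → a ≈ rhs b c d
  rhs-intro a b c d D ld≈D balanced =
    move a e _ (move (a + e) ((x + y) * c) _ (cancel _ _ (x * y * D) (begin
      a + e + (x + y) * c + x * y * D   ≈⟨ regroup a e ((x + y) * c) (x * y * D) ⟩
      a + (x + y) * c + (e + x * y * D) ≈⟨ +-congˡ (≈-trans (+-congʳ e≈) (x[1-y]+xy D)) ⟩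
      a + (x + y) * c + x * D           ≈⟨ balanced ⟩
      (1# + x + y) * b + x * y * D      ∎)))
    where
    e : Carrier
    e = x * (1# - y) * l * d
    e≈ : e ≈ x * (1# - y) * D
    e≈ = ≈-trans (*-assoc _ l d) (*-congˡ ld≈D)
    regroup : ∀ a e p q → a + e + p + q ≈ a + p + (e + q)
    regroup = solve 4 (λ a e p q → a :+ e :+ p :+ q := a :+ p :+ (e :+ q)) ≈-refl

  rhs-0 : 0# ≈ rhs 0# 0# 0#
  rhs-0 = rhs-intro 0# 0# 0# 0# 0# (zeroʳ l)
    (solve 2 (λ x y → con 0 :+ (x :+ y) :* con 0 :+ x :* con 0
                    := (con 1 :+ x :+ y) :* con 0 :+ x :* y :* con 0) ≈-refl x y)

  -- The per-W identities: the four summands of J(G) against those of the right-hand side,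
  -- with X = x^|W| and Y = y^|N_{G-u-v}(W)|.
  dominated-identity : ∀ X Y →
    (X * (y * (y * Y)) + (x * X) * (y * Y)) + ((x * X) * (y * Y) + (x * (x * X)) * Y)
    ≈ rhs ((X * (y * Y) + 0#) + ((x * X) * Y + 0#)) ((X * Y + 0#) + (0# + 0#)) ((0# + 0#) + (0# + 0#))
  dominated-identity X Y = rhs-intro _ _ _ _ 0#
    (solve 1 (λ l → l :* ((con 0 :+ con 0) :+ (con 0 :+ con 0)) := con 0) ≈-refl l)
    (solve 4 (λ x y X Y →
        (X :* (y :* (y :* Y)) :+ (x :* X) :* (y :* Y)) :+ ((x :* X) :* (y :* Y) :+ (x :* (x :* X)) :* Y)
        :+ (x :+ y) :* ((X :* Y :+ con 0) :+ (con 0 :+ con 0)) :+ x :* con 0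
      := (con 1 :+ x :+ y) :* ((X :* (y :* Y) :+ con 0) :+ ((x :* X) :* Y :+ con 0))
        :+ x :* y :* con 0) ≈-refl x y X Y)

  -- Here moreover M = y^|N_{G-N[u]}(W)| and C = y^|N_{G-u-v}(W+u)| = M·l.
  undominated-identity : ∀ X Y M C → M * l ≈ C →
    (X * Y + (x * X) * (y * C)) + ((x * X) * (y * C) + (x * (x * X)) * C)
    ≈ rhs ((X * Y + 0#) + ((x * X) * C + 0#)) ((X * Y + 0#) + (0# + 0#)) ((X * M + 0#) + (0# + 0#))
  undominated-identity X Y M C Ml≈C = rhs-intro _ _ _ _ (X * C)
    (≈-trans (solve 3 (λ l X M → l :* ((X :* M :+ con 0) :+ (con 0 :+ con 0)) := X :* (M :* l)) ≈-refl l X M)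
             (*-congˡ Ml≈C))
    (solve 5 (λ x y X Y C →
        (X :* Y :+ (x :* X) :* (y :* C)) :+ ((x :* X) :* (y :* C) :+ (x :* (x :* X)) :* C)
        :+ (x :+ y) :* ((X :* Y :+ con 0) :+ (con 0 :+ con 0)) :+ x :* (X :* C)
      := (con 1 :+ x :+ y) :* ((X :* Y :+ con 0) :+ ((x :* X) :* C :+ con 0))
        :+ x :* y :* (X :* C)) ≈-refl x y X Y C)

  pow-+ : ∀ a i k → pow R a (i +ℕ k) ≈ pow R a i * pow R a k
  pow-+ a zero    k = ≈-sym (*-identityˡ _)
  pow-+ a (suc i) k = ≈-trans (*-congˡ (pow-+ a i k)) (≈-sym (*-assoc _ _ _))

  term : Subset n → Subset n → Carrier
  term S = domTerm G S x y

  term-in : ∀ S W′ {i k} → does (W′ ⊆? S) ≡ true → ∣ W′ ∣ ≡ i → ∣ openNbhdSet G S W′ ∣ ≡ k →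
    term S W′ ≡ pow R x i * pow R y k
  term-in S W′ W′⊆S refl refl rewrite W′⊆S = refl

  term-out : ∀ S W′ → does (W′ ⊆? S) ≡ false → term S W′ ≡ 0#
  term-out S W′ W′⊄S rewrite W′⊄S = refl

  sum4-≡ : ∀ {a a′ b b′ c c′ d d′ : Carrier} → a ≡ a′ → b ≡ b′ → c ≡ c′ → d ≡ d′ →
    (a + b) + (c + d) ≡ (a′ + b′) + (c′ + d′)
  sum4-≡ refl refl refl refl = refl

  rhs-≡ : ∀ {b b′ c c′ d d′} → b ≡ b′ → c ≡ c′ → d ≡ d′ → rhs b c d ≡ rhs b′ c′ d′
  rhs-≡ refl refl refl = refl

  quadruple-identity-dominated : ∀ W → lookup W u ≡ false → lookup W v ≡ false →
    adjacentTo W u ≡ true →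
    quadruple u v (term ⊤) W
    ≈ rhs (quadruple u v (term V∖v) W) (quadruple u v (term V∖vu) W) (quadruple u v (term V∖N[u]) W)
  quadruple-identity-dominated W u∉W v∉W hit = begin
    quadruple u v (term ⊤) W
      ≡⟨ sum4-≡ (term-in ⊤ W (⊆⊤ W) refl ∣N-W∣)
                (term-in ⊤ Wv (⊆⊤ Wv) ∣Wv∣ (trans size-Wv (cong (suc ∘ ∣_∣) core-Wu)))
                (term-in ⊤ Wu (⊆⊤ Wu) ∣Wu∣ (trans size-Wu (cong (suc ∘ ∣_∣) core-Wu)))
                (term-in ⊤ Wuv (⊆⊤ Wuv) ∣Wuv∣ (trans size-Wuv (cong ∣_∣ core-Wu))) ⟩
    (X * (y * (y * Y)) + (x * X) * (y * Y)) + ((x * X) * (y * Y) + (x * (x * X)) * Y)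
      ≈⟨ dominated-identity X Y ⟩
    rhs ((X * (y * Y) + 0#) + ((x * X) * Y + 0#)) ((X * Y + 0#) + (0# + 0#)) ((0# + 0#) + (0# + 0#))
      ≡⟨ sym (rhs-≡
           (sum4-≡ (term-in V∖v W W⊆V∖v refl ∣N-v-W∣) (term-out V∖v Wv Wv⊄V∖v)
                   (term-in V∖v Wu Wu⊆V∖v ∣Wu∣ (trans size-V∖v-Wu (cong ∣_∣ core-Wu)))
                   (term-out V∖v Wuv Wuv⊄V∖v))
           (sum4-≡ (term-in V∖vu W W⊆V∖vu refl refl) (term-out V∖vu Wv Wv⊄V∖vu)
                   (term-out V∖vu Wu Wu⊄V∖vu) (term-out V∖vu Wuv Wuv⊄V∖vu))
           (sum4-≡ (term-out V∖N[u] W W⊄V∖N[u]) (term-out V∖N[u] Wv Wv⊄V∖N[u])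
                   (term-out V∖N[u] Wu Wu⊄V∖N[u]) (term-out V∖N[u] Wuv Wuv⊄V∖N[u]))) ⟩
    rhs (quadruple u v (term V∖v) W) (quadruple u v (term V∖vu) W) (quadruple u v (term V∖N[u]) W) ∎
    where
    open Quadruple W u∉W v∉W
    open Dominated hit
    X Y : Carrier
    X = pow R x ∣ W ∣
    Y = pow R y ∣ core W ∣

  quadruple-identity-undominated : ∀ W → lookup W u ≡ false → lookup W v ≡ false →
    adjacentTo W u ≡ false →
    quadruple u v (term ⊤) W
    ≈ rhs (quadruple u v (term V∖v) W) (quadruple u v (term V∖vu) W) (quadruple u v (term V∖N[u]) W)
  quadruple-identity-undominated W u∉W v∉W miss = begin
    quadruple u v (term ⊤) W
      ≡⟨ sum4-≡ (term-in ⊤ W (⊆⊤ W) refl ∣N-W∣)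
                (term-in ⊤ Wv (⊆⊤ Wv) ∣Wv∣ size-Wv)
                (term-in ⊤ Wu (⊆⊤ Wu) ∣Wu∣ size-Wu)
                (term-in ⊤ Wuv (⊆⊤ Wuv) ∣Wuv∣ size-Wuv) ⟩
    (X * Y + (x * X) * (y * C)) + ((x * X) * (y * C) + (x * (x * X)) * C)
      ≈⟨ undominated-identity X Y (pow R y ∣ M ∣) C Ml≈C ⟩
    rhs ((X * Y + 0#) + ((x * X) * C + 0#)) ((X * Y + 0#) + (0# + 0#))
        ((X * pow R y ∣ M ∣ + 0#) + (0# + 0#))
      ≡⟨ sym (rhs-≡
           (sum4-≡ (term-in V∖v W W⊆V∖v refl ∣N-v-W∣) (term-out V∖v Wv Wv⊄V∖v)
                   (term-in V∖v Wu Wu⊆V∖v ∣Wu∣ size-V∖v-Wu) (term-out V∖v Wuv Wuv⊄V∖v))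
           (sum4-≡ (term-in V∖vu W W⊆V∖vu refl refl) (term-out V∖vu Wv Wv⊄V∖vu)
                   (term-out V∖vu Wu Wu⊄V∖vu) (term-out V∖vu Wuv Wuv⊄V∖vu))
           (sum4-≡ (term-in V∖N[u] W W⊆V∖N[u] refl refl) (term-out V∖N[u] Wv Wv⊄V∖N[u])
                   (term-out V∖N[u] Wu Wu⊄V∖N[u]) (term-out V∖N[u] Wuv Wuv⊄V∖N[u]))) ⟩
    rhs (quadruple u v (term V∖v) W) (quadruple u v (term V∖vu) W) (quadruple u v (term V∖N[u]) W) ∎
    where
    open Quadruple W u∉W v∉W
    open Undominated miss
    X Y C : Carrier
    X = pow R x ∣ W ∣
    Y = pow R y ∣ core W ∣
    C = pow R y ∣ core Wu ∣
    Ml≈C : pow R y ∣ M ∣ * l ≈ C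
    Ml≈C = ≈-sym (begin
      pow R y ∣ core Wu ∣                    ≡⟨ cong (pow R y) ∣core-Wu∣ ⟩
      pow R y (∣ M ∣ +ℕ ∣ L ∣)               ≈⟨ pow-+ y ∣ M ∣ ∣ L ∣ ⟩
      pow R y ∣ M ∣ * pow R y ∣ L ∣          ≡⟨ cong (λ k → pow R y ∣ M ∣ * pow R y k) (sym ∣L∣) ⟩
      pow R y ∣ M ∣ * l                      ∎)

  quadruple-identity : ∀ W → lookup W u ≡ false → lookup W v ≡ false →
    quadruple u v (term ⊤) W
    ≈ rhs (quadruple u v (term V∖v) W) (quadruple u v (term V∖vu) W) (quadruple u v (term V∖N[u]) W)
  quadruple-identity W u∉W v∉W with adjacentTo W u in dominated?
  ... | true  = quadruple-identity-dominated W u∉W v∉W dominated?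
  ... | false = quadruple-identity-undominated W u∉W v∉W dominated?

  grouped-identity : ∀ W → grouped u v (term ⊤) W
    ≈ rhs (grouped u v (term V∖v) W) (grouped u v (term V∖vu) W) (grouped u v (term V∖N[u]) W)
  grouped-identity W with lookup W u in u∈W? | lookup W v in v∈W?
  ... | true  | _     = rhs-0
  ... | false | true  = rhs-0
  ... | false | false = quadruple-identity W u∈W? v∈W?

  J-grouped : ∀ S → J R G S x y ≈ ΣS n (grouped u v (term S))
  J-grouped S = ≈-trans (J-as-ΣS G S x y) (split-at-two n u≢v (term S))

  recurrence : J R G ⊤ x y ≈ rhs (J R G V∖v x y) (J R G V∖vu x y) (J R G V∖N[u] x y)
  recurrence = begin
    J R G ⊤ x y
      ≈⟨ J-grouped ⊤ ⟩
    ΣS n (grouped u v (term ⊤))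
      ≈⟨ ΣS-cong n grouped-identity ⟩
    ΣS n (λ W → rhs (grouped u v (term V∖v) W) (grouped u v (term V∖vu) W) (grouped u v (term V∖N[u]) W))
      ≈⟨ ΣS-linear n _ _ _ _ _ _ ⟩
    rhs (ΣS n (grouped u v (term V∖v))) (ΣS n (grouped u v (term V∖vu))) (ΣS n (grouped u v (term V∖N[u])))
      ≈⟨ ≈-sym (rhs-cong (J-grouped V∖v) (J-grouped V∖vu) (J-grouped V∖N[u])) ⟩
    rhs (J R G V∖v x y) (J R G V∖vu x y) (J R G V∖N[u] x y) ∎

corollary4 : ∀ {c ℓ : Level} (R : CommutativeRing c ℓ) {n} (G : Graph n) (u v : Fin n) →
    u ~[ G ] v →
    nbhd G (⊤ ─ ⁅ v ⁆) u ≡ nbhd G (⊤ ─ ⁅ u ⁆) v →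
    (∀ a b → a ∈ nbhd G (⊤ ─ ⁅ v ⁆) u → b ∈ nbhd G (⊤ ─ ⁅ v ⁆) u → a ≢ b → a ~[ G ] b) →
    let open CommutativeRing R in
    ∀ (x y : Carrier) →
      J R G ⊤ x y
        ≈ (1# + x + y) * J R G (⊤ ─ ⁅ v ⁆) x y
          - (x + y) * J R G (⊤ ─ ⁅ v ⁆ ─ ⁅ u ⁆) x y
          - x * (1# - y) * pow R y (∣ nbhd G ⊤ u ∣ ∸ 1) * J R G (⊤ ─ closedNbhd G ⊤ u) x y
corollary4 R G u v u~v twins L-clique x y = Recurrence.recurrence R G u v u~v twins L-clique x y
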